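{- Let $t$ be the translation from $\mathcal{L}_\mathsf{PAL}$ to $\mathcal{L}_\mathsf{EL}$ defined below, extended to relational atoms and labelled formulas by $t(x\sim_ay)=x\sim_ay$ and $t(x:\varphi)=x:t(\varphi)$, and to multisets elementwise. For every $\mathcal{L}_\mathsf{PAL}$-formula $\varphi$, every label $x$, and all finite multisets $\Gamma,\Delta$ of relational atoms and labelled $\mathcal{L}_\mathsf{PAL}$-formulas: (1) if $G_\mathsf{PAL}\vdash x:t(\varphi),t(\Gamma)\Rightarrow t(\Delta)$, then $G_\mathsf{PAL}\vdash x:\varphi,t(\Gamma)\Rightarrow t(\Delta)$; (2) if $G_\mathsf{PAL}\vdash t(\Gamma)\Rightarrow t(\Delta),x:t(\varphi)$, then $G_\mathsf{PAL}\vdash t(\Gamma)\Rightarrow t(\Delta),x:\varphi$.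
   Context: Fix a denumerable set $\mathsf{Prop}$ of propositional variables and a finite set $\mathsf{Ag}$ of agents. $\mathcal{L}_\mathsf{PAL}$-formulas are given by $\varphi ::= p \mid \neg\varphi \mid \varphi\land\varphi \mid \varphi\to\varphi \mid K_a\varphi \mid [\varphi]\varphi$ with $p\in\mathsf{Prop}$, $a\in\mathsf{Ag}$; $\mathcal{L}_\mathsf{EL}$ is the fragment without $[\cdot]$. Fix a countable set of labels $x,y,z,\dots$. A relational atom is $x\sim_a y$; a labelled formula is $x:\varphi$. A labelled sequent $\Gamma\Rightarrow\Delta$ has $\Gamma,\Delta$ finite multisets of relational atoms and labelled formulas. The translation $t:\mathcal{L}_\mathsf{PAL}\to\mathcal{L}_\mathsf{EL}$ is defined by: $t(p)=p$, $t(\neg\varphi)=\neg t(\varphi)$, $t(\varphi\land\psi)=t(\varphi)\land t(\psi)$, $t(\varphi\to\psi)=t(\varphi)\to t(\psi)$, $t(K_a\varphi)=K_at(\varphi)$, $t([\varphi]p)=t(\varphi\to p)$, $t([\varphi]\neg\psi)=t(\varphi\to\neg[\varphi]\psi)$, $t([\varphi](\psi\land\chi))=t([\varphi]\psi\land[\varphi]\chi)$, $t([\varphi](\psi\to\chi))=t([\varphi]\psi\to[\varphi]\chi)$, $t([\varphi]K_a\psi)=t(\varphi\to K_a[\varphi]\psi)$, $t([\varphi][\psi]\chi)=t([\varphi\land[\varphi]\psi]\chi)$ (this recursion is well-founded with respect to the complexity measure $c(p)=1$, $c(\neg\varphi)=c(K_a\varphi)-0=1+c(\varphi)$ for $\neg,K_a$,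 $c(\varphi\land\psi)=c(\varphi\to\psi)=1+\max\{c(\varphi),c(\psi)\}$, $c([\varphi]\psi)=(4+c(\varphi))\cdot c(\psi)$). The calculus $G_\mathsf{EL}$ has initial sequents $x:p,\Gamma\Rightarrow\Delta,x:p$ and $x\sim_ay,\Gamma\Rightarrow\Delta,x\sim_ay$ and the rules: $(\neg\Rightarrow)\ \frac{\Gamma\Rightarrow\Delta,x:\varphi}{x:\neg\varphi,\Gamma\Rightarrow\Delta}$; $(\Rightarrow\neg)\ \frac{x:\varphi,\Gamma\Rightarrow\Delta}{\Gamma\Rightarrow\Delta,x:\neg\varphi}$; $(\land\Rightarrow)\ \frac{x:\varphi_1,x:\varphi_2,\Gamma\Rightarrow\Delta}{x:\varphi_1\land\varphi_2,\Gamma\Rightarrow\Delta}$; $(\Rightarrow\land)\ \frac{\Gamma\Rightarrow\Delta,x:\varphi_1\quad \Gamma\Rightarrow\Delta,x:\varphi_2}{\Gamma\Rightarrow\Delta,x:\varphi_1\land\varphi_2}$; $(\to\Rightarrow)\ \frac{\Gamma\Rightarrow\Delta,x:\varphi\quad x:\psi,\Gamma\Rightarrow\Delta}{x:\varphi\to\psi,\Gamma\Rightarrow\Delta}$; $(\Rightarrow\to)\ \frac{x:\varphi,\Gamma\Rightarrow\Delta,x:\psi}{\Gamma\Rightarrow\Delta,x:\varphi\to\psi}$; $(K_a\Rightarrow)\ \frac{y:\varphi,x:K_a\varphi,x\sim_ay,\Gamma\Rightarrow\Delta}{x:K_a\varphi,x\sim_ay,\Gamma\Rightarrow\Delta}$;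 $(\Rightarrow K_a)\ \frac{x\sim_ay,\Gamma\Rightarrow\Delta,y:\varphi}{\Gamma\Rightarrow\Delta,x:K_a\varphi}$ with $y$ not occurring in the conclusion; $(\mathrm{Ref}_a)\ \frac{x\sim_ax,\Gamma\Rightarrow\Delta}{\Gamma\Rightarrow\Delta}$; $(\mathrm{Trans}_a)\ \frac{x\sim_az,x\sim_ay,y\sim_az,\Gamma\Rightarrow\Delta}{x\sim_ay,y\sim_az,\Gamma\Rightarrow\Delta}$; $(\mathrm{Sym}_a)\ \frac{y\sim_ax,x\sim_ay,\Gamma\Rightarrow\Delta}{x\sim_ay,\Gamma\Rightarrow\Delta}$. $G_\mathsf{PAL}$ is $G_\mathsf{EL}$ (with formulas ranging over $\mathcal{L}_\mathsf{PAL}$) plus the reduction rules: $(R1\Rightarrow)\ \frac{\Gamma\Rightarrow\Delta,x:\varphi\quad x:p,\Gamma\Rightarrow\Delta}{x:[\varphi]p,\Gamma\Rightarrow\Delta}$; $(\Rightarrow R1)\ \frac{x:\varphi,\Gamma\Rightarrow\Delta,x:p}{\Gamma\Rightarrow\Delta,x:[\varphi]p}$; $(R2\Rightarrow)\ \frac{\Gamma\Rightarrow\Delta,x:\varphi\quad x:\neg[\varphi]\psi,\Gamma\Rightarrow\Delta}{x:[\varphi]\neg\psi,\Gamma\Rightarrow\Delta}$; $(\Rightarrow R2)\ \frac{x:\varphi,\Gamma\Rightarrow\Delta,x:\neg[\varphi]\psi}{\Gamma\Rightarrow\Delta,x:[\varphi]\neg\psi}$; $(R3\Rightarrow)\ \frac{x:[\varphi]\psi_1,x:[\varphi]\psi_2,\Gamma\Rightarrow\Delta}{x:[\varphi](\psi_1\land\psi_2),\Gamma\Rightarrow\Delta}$;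 $(\Rightarrow R3)\ \frac{\Gamma\Rightarrow\Delta,x:[\varphi]\psi_1\quad\Gamma\Rightarrow\Delta,x:[\varphi]\psi_2}{\Gamma\Rightarrow\Delta,x:[\varphi](\psi_1\land\psi_2)}$; $(R4\Rightarrow)\ \frac{\Gamma\Rightarrow\Delta,x:[\varphi]\psi_1\quad x:[\varphi]\psi_2,\Gamma\Rightarrow\Delta}{x:[\varphi](\psi_1\to\psi_2),\Gamma\Rightarrow\Delta}$; $(\Rightarrow R4)\ \frac{x:[\varphi]\psi_1,\Gamma\Rightarrow\Delta,x:[\varphi]\psi_2}{\Gamma\Rightarrow\Delta,x:[\varphi](\psi_1\to\psi_2)}$; $(R5\Rightarrow)\ \frac{\Gamma\Rightarrow\Delta,x:\varphi\quad x:K_a[\varphi]\psi,\Gamma\Rightarrow\Delta}{x:[\varphi]K_a\psi,\Gamma\Rightarrow\Delta}$; $(\Rightarrow R5)\ \frac{x:\varphi,\Gamma\Rightarrow\Delta,x:K_a[\varphi]\psi}{\Gamma\Rightarrow\Delta,x:[\varphi]K_a\psi}$; $(R6\Rightarrow)\ \frac{x:[\varphi\land[\varphi]\psi]\chi,\Gamma\Rightarrow\Delta}{x:[\varphi][\psi]\chi,\Gamma\Rightarrow\Delta}$; $(\Rightarrow R6)\ \frac{\Gamma\Rightarrow\Delta,x:[\varphi\land[\varphi]\psi]\chi}{\Gamma\Rightarrow\Delta,x:[\varphi][\psi]\chi}$. Derivations are finite trees built from these rules with initial sequents at the leaves; $G\vdash S$ means $S$ is derivable in $G$. -}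

module Defs where

open import Data.Nat using (ℕ; zero; suc; _+_; _*_; _⊔_)
open import Data.Fin using (Fin)
open import Data.List using (List; []; _∷_; map)
open import Data.List.Relation.Unary.All using (All)
open import Data.List.Relation.Binary.Permutation.Propositional using (_↭_)
open import Data.Product using (_×_)
open import Relation.Binary.PropositionalEquality using (_≡_; _≢_)

Prop : Set
Prop = ℕ

Label : Set
Label = ℕ

-- L_PAL formulas over the agent set Fin n.  L_EL is the fragment without [_]_.
infixr 6 _∧_
infixr 5 _⇒_
data Fm (n : ℕ) : Set where
  var  : Prop → Fm n
  ¬_   : Fm n → Fm n
  _∧_  : Fm n → Fm n → Fm n
  _⇒_  : Fm n → Fm n → Fm n
  K    : Fin n → Fm n → Fm n
  [_]_ : Fm n → Fm n → Fm n

c : ∀ {n} → Fm n → ℕ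
c (var p)   = 1
c (¬ φ)     = suc (c φ)
c (K a φ)   = suc (c φ)
c (φ ∧ ψ)   = suc (c φ ⊔ c ψ)
c (φ ⇒ ψ)   = suc (c φ ⊔ c ψ)
c ([ φ ] ψ) = (4 + c φ) * c ψ

-- The recursion is
-- well-founded w.r.t. c (every recursive call is on a formula of strictly
-- smaller c), so running it with fuel c φ computes t exactly; the fuel = 0
-- clause is never reached from  t φ = tF (c φ) φ.
tF : ∀ {n} → ℕ → Fm n → Fm n
tF zero    φ                 = φ
tF (suc k) (var p)           = var p
tF (suc k) (¬ φ)             = ¬ tF k φ
tF (suc k) (φ ∧ ψ)           = tF k φ ∧ tF k ψ
tF (suc k) (φ ⇒ ψ)           = tF k φ ⇒ tF k ψ
tF (suc k) (K a φ)           = K a (tF k φ)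
tF (suc k) ([ φ ] var p)     = tF k (φ ⇒ var p)
tF (suc k) ([ φ ] (¬ ψ))     = tF k (φ ⇒ ¬ ([ φ ] ψ))
tF (suc k) ([ φ ] (ψ ∧ χ))   = tF k (([ φ ] ψ) ∧ ([ φ ] χ))
tF (suc k) ([ φ ] (ψ ⇒ χ))   = tF k (([ φ ] ψ) ⇒ ([ φ ] χ))
tF (suc k) ([ φ ] K a ψ)     = tF k (φ ⇒ K a ([ φ ] ψ))
tF (suc k) ([ φ ] ([ ψ ] χ)) = tF k ([ φ ∧ ([ φ ] ψ) ] χ)

t : ∀ {n} → Fm n → Fm n
t φ = tF (c φ) φ

data Elem (n : ℕ) : Set where
  rel : Label → Fin n → Label → Elem n     -- rel x a y  is  x ~_a y
  lab : Label → Fm n → Elem n              -- lab x φ    is  x : φ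

tE : ∀ {n} → Elem n → Elem n
tE (rel x a y) = rel x a y
tE (lab x φ)   = lab x (t φ)

tL : ∀ {n} → List (Elem n) → List (Elem n)
tL = map tE

NotIn : ∀ {n} → Label → Elem n → Set
NotIn y (rel x a z) = (y ≢ x) × (y ≢ z)
NotIn y (lab x φ)   = y ≢ x

-- Multisets are represented by lists,
-- with an exchange rule (closure under permutation on both sides).
-- The principal/"Δ, x:φ" positions are written at the head of the lists.
infix 3 _⊢_
data _⊢_ {n : ℕ} : List (Elem n) → List (Elem n) → Set where
  perm : ∀ {Γ Γ' Δ Δ'} → Γ ↭ Γ' → Δ ↭ Δ' → Γ ⊢ Δ → Γ' ⊢ Δ'
  idP  : ∀ {x p Γ Δ} → lab x (var p) ∷ Γ ⊢ lab x (var p) ∷ Δ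
  idR  : ∀ {x a y Γ Δ} → rel x a y ∷ Γ ⊢ rel x a y ∷ Δ
  ¬L   : ∀ {x φ Γ Δ} → Γ ⊢ lab x φ ∷ Δ → lab x (¬ φ) ∷ Γ ⊢ Δ
  ¬R   : ∀ {x φ Γ Δ} → lab x φ ∷ Γ ⊢ Δ → Γ ⊢ lab x (¬ φ) ∷ Δ
  ∧L   : ∀ {x φ ψ Γ Δ} → lab x φ ∷ lab x ψ ∷ Γ ⊢ Δ → lab x (φ ∧ ψ) ∷ Γ ⊢ Δ
  ∧R   : ∀ {x φ ψ Γ Δ} → Γ ⊢ lab x φ ∷ Δ → Γ ⊢ lab x ψ ∷ Δ → Γ ⊢ lab x (φ ∧ ψ) ∷ Δ
  ⇒L   : ∀ {x φ ψ Γ Δ} → Γ ⊢ lab x φ ∷ Δ → lab x ψ ∷ Γ ⊢ Δ → lab x (φ ⇒ ψ) ∷ Γ ⊢ Δ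
  ⇒R   : ∀ {x φ ψ Γ Δ} → lab x φ ∷ Γ ⊢ lab x ψ ∷ Δ → Γ ⊢ lab x (φ ⇒ ψ) ∷ Δ
  KL   : ∀ {x y a φ Γ Δ} → lab y φ ∷ lab x (K a φ) ∷ rel x a y ∷ Γ ⊢ Δ
                         → lab x (K a φ) ∷ rel x a y ∷ Γ ⊢ Δ
  KR   : ∀ {x y a φ Γ Δ} → y ≢ x → All (NotIn y) Γ → All (NotIn y) Δ
                         → rel x a y ∷ Γ ⊢ lab y φ ∷ Δ → Γ ⊢ lab x (K a φ) ∷ Δ
  Ref  : ∀ {x a Γ Δ} → rel x a x ∷ Γ ⊢ Δ → Γ ⊢ Δ
  Trans : ∀ {x y z a Γ Δ} → rel x a z ∷ rel x a y ∷ rel y a z ∷ Γ ⊢ Δ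
                          → rel x a y ∷ rel y a z ∷ Γ ⊢ Δ
  Sym  : ∀ {x y a Γ Δ} → rel y a x ∷ rel x a y ∷ Γ ⊢ Δ → rel x a y ∷ Γ ⊢ Δ
  R1L  : ∀ {x φ p Γ Δ} → Γ ⊢ lab x φ ∷ Δ → lab x (var p) ∷ Γ ⊢ Δ
                       → lab x ([ φ ] var p) ∷ Γ ⊢ Δ
  R1R  : ∀ {x φ p Γ Δ} → lab x φ ∷ Γ ⊢ lab x (var p) ∷ Δ
                       → Γ ⊢ lab x ([ φ ] var p) ∷ Δ
  R2L  : ∀ {x φ ψ Γ Δ} → Γ ⊢ lab x φ ∷ Δ → lab x (¬ ([ φ ] ψ)) ∷ Γ ⊢ Δ
                       → lab x ([ φ ] (¬ ψ)) ∷ Γ ⊢ Δ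
  R2R  : ∀ {x φ ψ Γ Δ} → lab x φ ∷ Γ ⊢ lab x (¬ ([ φ ] ψ)) ∷ Δ
                       → Γ ⊢ lab x ([ φ ] (¬ ψ)) ∷ Δ
  R3L  : ∀ {x φ ψ₁ ψ₂ Γ Δ} → lab x ([ φ ] ψ₁) ∷ lab x ([ φ ] ψ₂) ∷ Γ ⊢ Δ
                           → lab x ([ φ ] (ψ₁ ∧ ψ₂)) ∷ Γ ⊢ Δ
  R3R  : ∀ {x φ ψ₁ ψ₂ Γ Δ} → Γ ⊢ lab x ([ φ ] ψ₁) ∷ Δ → Γ ⊢ lab x ([ φ ] ψ₂) ∷ Δ
                           → Γ ⊢ lab x ([ φ ] (ψ₁ ∧ ψ₂)) ∷ Δ
  R4L  : ∀ {x φ ψ₁ ψ₂ Γ Δ} → Γ ⊢ lab x ([ φ ] ψ₁) ∷ Δ → lab x ([ φ ] ψ₂) ∷ Γ ⊢ Δ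
                           → lab x ([ φ ] (ψ₁ ⇒ ψ₂)) ∷ Γ ⊢ Δ
  R4R  : ∀ {x φ ψ₁ ψ₂ Γ Δ} → lab x ([ φ ] ψ₁) ∷ Γ ⊢ lab x ([ φ ] ψ₂) ∷ Δ
                           → Γ ⊢ lab x ([ φ ] (ψ₁ ⇒ ψ₂)) ∷ Δ
  R5L  : ∀ {x a φ ψ Γ Δ} → Γ ⊢ lab x φ ∷ Δ → lab x (K a ([ φ ] ψ)) ∷ Γ ⊢ Δ
                         → lab x ([ φ ] K a ψ) ∷ Γ ⊢ Δ
  R5R  : ∀ {x a φ ψ Γ Δ} → lab x φ ∷ Γ ⊢ lab x (K a ([ φ ] ψ)) ∷ Δ
                         → Γ ⊢ lab x ([ φ ] K a ψ) ∷ Δ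
  R6L  : ∀ {x φ ψ χ Γ Δ} → lab x ([ φ ∧ ([ φ ] ψ) ] χ) ∷ Γ ⊢ Δ
                         → lab x ([ φ ] ([ ψ ] χ)) ∷ Γ ⊢ Δ
  R6R  : ∀ {x φ ψ χ Γ Δ} → Γ ⊢ lab x ([ φ ∧ ([ φ ] ψ) ] χ) ∷ Δ
                         → Γ ⊢ lab x ([ φ ] ([ ψ ] χ)) ∷ Δ

module Submission where

-- Call A a reduct of φ (φ ↝ A) when A arises from φ by applying the reduction
-- axioms R1–R6 at some of the places where the recursion defining t applies
-- them; t φ is one.  A rule of G_PAL introducing the main connective of a reduct
-- A is simulated on φ itself: by the same rule if that connective was already
-- there, and otherwise by the G_PAL rule of the reduction axiom that produced it,
-- preceded by R6 steps.  So, by induction on derivations, derivability survives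
-- replacing formulas anywhere in a sequent by formulas that reduce to them.

open import Defs
open import Data.Nat using (ℕ; zero; suc)
open import Data.List using (List; _∷_)
open import Data.List.Relation.Unary.All using (All)
open import Data.List.Relation.Binary.Pointwise using (Pointwise; []; _∷_; All-resp-Pointwise)
import Data.List.Relation.Binary.Pointwise as Pointwise
open import Data.List.Relation.Binary.Permutation.Propositional using (_↭_; refl; prep; swap; trans)
open import Data.Product using (_×_; _,_; ∃-syntax)
open import Function using (id; flip)
open import Relation.Binary.Definitions using (_Respects_)
open import Relation.Binary.PropositionalEquality using (_≡_; refl; _≢_)

module _ {a r} {A : Set a} {R : A → A → Set r} where

  Pointwise-↭ : ∀ {xs ys ys′} → ys ↭ ys′ → Pointwise R xs ys′
              → ∃[ xs′ ] Pointwise R xs′ ys × xs′ ↭ xs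
  Pointwise-↭ refl rs = _ , rs , refl
  Pointwise-↭ (prep y p) (r ∷ rs) with Pointwise-↭ p rs
  ... | _ , rs′ , q = _ , r ∷ rs′ , prep _ q
  Pointwise-↭ (swap y z p) (r ∷ s ∷ rs) with Pointwise-↭ p rs
  ... | _ , rs′ , q = _ , s ∷ r ∷ rs′ , swap _ _ q
  Pointwise-↭ (trans p q) rs with Pointwise-↭ q rs
  ... | _ , rs₁ , q′ with Pointwise-↭ p rs₁
  ... | _ , rs₂ , p′ = _ , rs₂ , trans p′ q′

module _ {n : ℕ} where

  -- Each reduction axiom is built in together with congruence on its reduct, so
  -- the heads of both sides determine the last constructor; a box left unreduced
  -- (as when tF runs out of fuel) is kept verbatim.
  infix 4 _↝_
  data _↝_ : Fm n → Fm n → Set where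
    var  : ∀ {p} → var p ↝ var p
    ¬_   : ∀ {φ A} → φ ↝ A → ¬ φ ↝ ¬ A
    _∧_  : ∀ {φ ψ A B} → φ ↝ A → ψ ↝ B → φ ∧ ψ ↝ A ∧ B
    _⇒_  : ∀ {φ ψ A B} → φ ↝ A → ψ ↝ B → φ ⇒ ψ ↝ A ⇒ B
    K    : ∀ {a φ A} → φ ↝ A → K a φ ↝ K a A
    [_]_ : ∀ φ ψ → [ φ ] ψ ↝ [ φ ] ψ
    R1   : ∀ {φ p A} → φ ↝ A → [ φ ] var p ↝ A ⇒ var p
    R2   : ∀ {φ ψ A B} → φ ↝ A → [ φ ] ψ ↝ B → [ φ ] (¬ ψ) ↝ A ⇒ ¬ B
    R3   : ∀ {φ ψ χ A B} → [ φ ] ψ ↝ A → [ φ ] χ ↝ B → [ φ ] (ψ ∧ χ) ↝ A ∧ B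
    R4   : ∀ {φ ψ χ A B} → [ φ ] ψ ↝ A → [ φ ] χ ↝ B → [ φ ] (ψ ⇒ χ) ↝ A ⇒ B
    R5   : ∀ {a φ ψ A B} → φ ↝ A → [ φ ] ψ ↝ B → [ φ ] K a ψ ↝ A ⇒ K a B
    R6   : ∀ {φ ψ χ A} → [ φ ∧ ([ φ ] ψ) ] χ ↝ A → [ φ ] ([ ψ ] χ) ↝ A

  ↝-refl : ∀ φ → φ ↝ φ
  ↝-refl (var p)   = var
  ↝-refl (¬ φ)     = ¬ ↝-refl φ
  ↝-refl (φ ∧ ψ)   = ↝-refl φ ∧ ↝-refl ψ
  ↝-refl (φ ⇒ ψ)   = ↝-refl φ ⇒ ↝-refl ψ
  ↝-refl (K a φ)   = K (↝-refl φ)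
  ↝-refl ([ φ ] ψ) = [ φ ] ψ

  R1-step : ∀ {φ p A} → φ ⇒ var p ↝ A → [ φ ] var p ↝ A
  R1-step (r ⇒ var) = R1 r

  R2-step : ∀ {φ ψ A} → φ ⇒ ¬ ([ φ ] ψ) ↝ A → [ φ ] (¬ ψ) ↝ A
  R2-step (r ⇒ (¬ s)) = R2 r s

  R3-step : ∀ {φ ψ χ A} → ([ φ ] ψ) ∧ ([ φ ] χ) ↝ A → [ φ ] (ψ ∧ χ) ↝ A
  R3-step (r ∧ s) = R3 r s

  R4-step : ∀ {φ ψ χ A} → ([ φ ] ψ) ⇒ ([ φ ] χ) ↝ A → [ φ ] (ψ ⇒ χ) ↝ A
  R4-step (r ⇒ s) = R4 r s

  R5-step : ∀ {a φ ψ A} → φ ⇒ K a ([ φ ] ψ) ↝ A → [ φ ] K a ψ ↝ A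
  R5-step (r ⇒ K s) = R5 r s

  tF-reduct : ∀ k φ → φ ↝ tF k φ
  tF-reduct zero    φ                 = ↝-refl φ
  tF-reduct (suc k) (var p)           = var
  tF-reduct (suc k) (¬ φ)             = ¬ tF-reduct k φ
  tF-reduct (suc k) (φ ∧ ψ)           = tF-reduct k φ ∧ tF-reduct k ψ
  tF-reduct (suc k) (φ ⇒ ψ)           = tF-reduct k φ ⇒ tF-reduct k ψ
  tF-reduct (suc k) (K a φ)           = K (tF-reduct k φ)
  tF-reduct (suc k) ([ φ ] var p)     = R1-step (tF-reduct k _)
  tF-reduct (suc k) ([ φ ] (¬ ψ))     = R2-step (tF-reduct k _)
  tF-reduct (suc k) ([ φ ] (ψ ∧ χ))   = R3-step (tF-reduct k _)
  tF-reduct (suc k) ([ φ ] (ψ ⇒ χ))   = R4-step (tF-reduct k _)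
  tF-reduct (suc k) ([ φ ] K a ψ)     = R5-step (tF-reduct k _)
  tF-reduct (suc k) ([ φ ] ([ ψ ] χ)) = R6 (tF-reduct k _)

  t-reduct : ∀ φ → φ ↝ t φ
  t-reduct φ = tF-reduct (c φ) φ

  infix 4 _↝ᴱ_
  data _↝ᴱ_ : Elem n → Elem n → Set where
    rel : ∀ {x a y} → rel x a y ↝ᴱ rel x a y
    lab : ∀ {x φ A} → φ ↝ A → lab x φ ↝ᴱ lab x A

  ↝ᴱ-refl : ∀ {e} → e ↝ᴱ e
  ↝ᴱ-refl {rel x a y} = rel
  ↝ᴱ-refl {lab x φ}   = lab (↝-refl φ)

  NotIn-resp-↜ᴱ : ∀ {y} → NotIn y Respects flip _↝ᴱ_
  NotIn-resp-↜ᴱ rel     h = h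
  NotIn-resp-↜ᴱ (lab _) h = h

  NotIn-expand : ∀ {y Γ Γᵣ} → Pointwise _↝ᴱ_ Γ Γᵣ → All (NotIn y) Γᵣ → All (NotIn y) Γ
  NotIn-expand γ = All-resp-Pointwise NotIn-resp-↜ᴱ (Pointwise.symmetric id γ)

  var-reduct : ∀ {φ p} → φ ↝ var p → φ ≡ var p
  var-reduct var = refl
  var-reduct (R6 r) with var-reduct r
  ... | ()

  module _ {Γ Δ : List (Elem n)} {x : Label} where

    []L-lift : ∀ {φ ψ χ} → φ ↝ [ ψ ] χ → lab x ([ ψ ] χ) ∷ Γ ⊢ Δ → lab x φ ∷ Γ ⊢ Δ
    []L-lift ([ ψ ] χ) d = d
    []L-lift (R6 r)    d = R6L ([]L-lift r d)

    []R-lift : ∀ {φ ψ χ} → φ ↝ [ ψ ] χ → Γ ⊢ lab x ([ ψ ] χ) ∷ Δ → Γ ⊢ lab x φ ∷ Δ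
    []R-lift ([ ψ ] χ) d = d
    []R-lift (R6 r)    d = R6R ([]R-lift r d)

    ¬L-lift : ∀ {φ A} → φ ↝ ¬ A
            → (∀ {ψ} → ψ ↝ A → Γ ⊢ lab x ψ ∷ Δ) → lab x φ ∷ Γ ⊢ Δ
    ¬L-lift (¬ r)  f = ¬L (f r)
    ¬L-lift (R6 r) f = R6L (¬L-lift r f)

    ¬R-lift : ∀ {φ A} → φ ↝ ¬ A
            → (∀ {ψ} → ψ ↝ A → lab x ψ ∷ Γ ⊢ Δ) → Γ ⊢ lab x φ ∷ Δ
    ¬R-lift (¬ r)  f = ¬R (f r)
    ¬R-lift (R6 r) f = R6R (¬R-lift r f)

    ∧L-lift : ∀ {φ A B} → φ ↝ A ∧ B
            → (∀ {ψ χ} → ψ ↝ A → χ ↝ B → lab x ψ ∷ lab x χ ∷ Γ ⊢ Δ) → lab x φ ∷ Γ ⊢ Δ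
    ∧L-lift (r ∧ s)  f = ∧L (f r s)
    ∧L-lift (R3 r s) f = R3L (f r s)
    ∧L-lift (R6 r)   f = R6L (∧L-lift r f)

    ∧R-lift : ∀ {φ A B} → φ ↝ A ∧ B
            → (∀ {ψ} → ψ ↝ A → Γ ⊢ lab x ψ ∷ Δ) → (∀ {χ} → χ ↝ B → Γ ⊢ lab x χ ∷ Δ)
            → Γ ⊢ lab x φ ∷ Δ
    ∧R-lift (r ∧ s)  f g = ∧R (f r) (g s)
    ∧R-lift (R3 r s) f g = R3R (f r) (g s)
    ∧R-lift (R6 r)   f g = R6R (∧R-lift r f g)

    ⇒L-lift : ∀ {φ A B} → φ ↝ A ⇒ B
            → (∀ {ψ} → ψ ↝ A → Γ ⊢ lab x ψ ∷ Δ) → (∀ {χ} → χ ↝ B → lab x χ ∷ Γ ⊢ Δ)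
            → lab x φ ∷ Γ ⊢ Δ
    ⇒L-lift (r ⇒ s)  f g = ⇒L (f r) (g s)
    ⇒L-lift (R1 r)   f g = R1L (f r) (g var)
    ⇒L-lift (R2 r s) f g = R2L (f r) (g (¬ s))
    ⇒L-lift (R4 r s) f g = R4L (f r) (g s)
    ⇒L-lift (R5 r s) f g = R5L (f r) (g (K s))
    ⇒L-lift (R6 r)   f g = R6L (⇒L-lift r f g)

    ⇒R-lift : ∀ {φ A B} → φ ↝ A ⇒ B
            → (∀ {ψ χ} → ψ ↝ A → χ ↝ B → lab x ψ ∷ Γ ⊢ lab x χ ∷ Δ) → Γ ⊢ lab x φ ∷ Δ
    ⇒R-lift (r ⇒ s)  f = ⇒R (f r s)
    ⇒R-lift (R1 r)   f = R1R (f r var)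
    ⇒R-lift (R2 r s) f = R2R (f r (¬ s))
    ⇒R-lift (R4 r s) f = R4R (f r s)
    ⇒R-lift (R5 r s) f = R5R (f r (K s))
    ⇒R-lift (R6 r)   f = R6R (⇒R-lift r f)

    KL-lift : ∀ {φ a y A} → φ ↝ K a A
            → (∀ {ψ φ′} → ψ ↝ A → φ′ ↝ K a A → lab y ψ ∷ lab x φ′ ∷ rel x a y ∷ Γ ⊢ Δ)
            → lab x φ ∷ rel x a y ∷ Γ ⊢ Δ
    KL-lift (K r)  f = KL (f r (K r))
    KL-lift (R6 r) f = R6L (KL-lift r f)

    KR-lift : ∀ {φ a y A} → y ≢ x → All (NotIn y) Γ → All (NotIn y) Δ → φ ↝ K a A
            → (∀ {ψ} → ψ ↝ A → rel x a y ∷ Γ ⊢ lab y ψ ∷ Δ) → Γ ⊢ lab x φ ∷ Δ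
    KR-lift y≢x yΓ yΔ (K r)  f = KR y≢x yΓ yΔ (f r)
    KR-lift y≢x yΓ yΔ (R6 r) f = R6R (KR-lift y≢x yΓ yΔ r f)

  ⊢-expand : ∀ {Γ Δ Γᵣ Δᵣ} → Γᵣ ⊢ Δᵣ
           → Pointwise _↝ᴱ_ Γ Γᵣ → Pointwise _↝ᴱ_ Δ Δᵣ → Γ ⊢ Δ
  ⊢-expand (perm p q d) γ δ with Pointwise-↭ p γ | Pointwise-↭ q δ
  ... | _ , γ′ , p′ | _ , δ′ , q′ = perm p′ q′ (⊢-expand d γ′ δ′)
  ⊢-expand idP (lab r ∷ _) (lab s ∷ _) with var-reduct r | var-reduct s
  ... | refl | refl = idP
  ⊢-expand idR (rel ∷ _) (rel ∷ _) = idR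
  ⊢-expand (¬L d) (lab r ∷ γ) δ = ¬L-lift r λ s → ⊢-expand d γ (lab s ∷ δ)
  ⊢-expand (¬R d) γ (lab r ∷ δ) = ¬R-lift r λ s → ⊢-expand d (lab s ∷ γ) δ
  ⊢-expand (∧L d) (lab r ∷ γ) δ = ∧L-lift r λ s₁ s₂ → ⊢-expand d (lab s₁ ∷ lab s₂ ∷ γ) δ
  ⊢-expand (∧R d₁ d₂) γ (lab r ∷ δ) =
    ∧R-lift r (λ s → ⊢-expand d₁ γ (lab s ∷ δ)) (λ s → ⊢-expand d₂ γ (lab s ∷ δ))
  ⊢-expand (⇒L d₁ d₂) (lab r ∷ γ) δ =
    ⇒L-lift r (λ s → ⊢-expand d₁ γ (lab s ∷ δ)) (λ s → ⊢-expand d₂ (lab s ∷ γ) δ)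
  ⊢-expand (⇒R d) γ (lab r ∷ δ) = ⇒R-lift r λ s₁ s₂ → ⊢-expand d (lab s₁ ∷ γ) (lab s₂ ∷ δ)
  ⊢-expand (KL d) (lab r ∷ rel ∷ γ) δ =
    KL-lift r λ s₁ s₂ → ⊢-expand d (lab s₁ ∷ lab s₂ ∷ rel ∷ γ) δ
  ⊢-expand (KR y≢x yΓ yΔ d) γ (lab r ∷ δ) =
    KR-lift y≢x (NotIn-expand γ yΓ) (NotIn-expand δ yΔ) r λ s → ⊢-expand d (rel ∷ γ) (lab s ∷ δ)
  ⊢-expand (Ref d) γ δ = Ref (⊢-expand d (rel ∷ γ) δ)
  ⊢-expand (Trans d) (rel ∷ rel ∷ γ) δ = Trans (⊢-expand d (rel ∷ rel ∷ rel ∷ γ) δ)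
  ⊢-expand (Sym d) (rel ∷ γ) δ = Sym (⊢-expand d (rel ∷ rel ∷ γ) δ)
  ⊢-expand (R1L d₁ d₂) (lab r ∷ γ) δ =
    []L-lift r (R1L (⊢-expand d₁ γ (↝ᴱ-refl ∷ δ)) (⊢-expand d₂ (↝ᴱ-refl ∷ γ) δ))
  ⊢-expand (R1R d) γ (lab r ∷ δ) = []R-lift r (R1R (⊢-expand d (↝ᴱ-refl ∷ γ) (↝ᴱ-refl ∷ δ)))
  ⊢-expand (R2L d₁ d₂) (lab r ∷ γ) δ =
    []L-lift r (R2L (⊢-expand d₁ γ (↝ᴱ-refl ∷ δ)) (⊢-expand d₂ (↝ᴱ-refl ∷ γ) δ))
  ⊢-expand (R2R d) γ (lab r ∷ δ) = []R-lift r (R2R (⊢-expand d (↝ᴱ-refl ∷ γ) (↝ᴱ-refl ∷ δ)))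
  ⊢-expand (R3L d) (lab r ∷ γ) δ = []L-lift r (R3L (⊢-expand d (↝ᴱ-refl ∷ ↝ᴱ-refl ∷ γ) δ))
  ⊢-expand (R3R d₁ d₂) γ (lab r ∷ δ) =
    []R-lift r (R3R (⊢-expand d₁ γ (↝ᴱ-refl ∷ δ)) (⊢-expand d₂ γ (↝ᴱ-refl ∷ δ)))
  ⊢-expand (R4L d₁ d₂) (lab r ∷ γ) δ =
    []L-lift r (R4L (⊢-expand d₁ γ (↝ᴱ-refl ∷ δ)) (⊢-expand d₂ (↝ᴱ-refl ∷ γ) δ))
  ⊢-expand (R4R d) γ (lab r ∷ δ) = []R-lift r (R4R (⊢-expand d (↝ᴱ-refl ∷ γ) (↝ᴱ-refl ∷ δ)))
  ⊢-expand (R5L d₁ d₂) (lab r ∷ γ) δ =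
    []L-lift r (R5L (⊢-expand d₁ γ (↝ᴱ-refl ∷ δ)) (⊢-expand d₂ (↝ᴱ-refl ∷ γ) δ))
  ⊢-expand (R5R d) γ (lab r ∷ δ) = []R-lift r (R5R (⊢-expand d (↝ᴱ-refl ∷ γ) (↝ᴱ-refl ∷ δ)))
  ⊢-expand (R6L d) (lab r ∷ γ) δ = []L-lift r (R6L (⊢-expand d (↝ᴱ-refl ∷ γ) δ))
  ⊢-expand (R6R d) γ (lab r ∷ δ) = []R-lift r (R6R (⊢-expand d γ (↝ᴱ-refl ∷ δ)))

mainTheorem2 : {n : ℕ} (φ : Fm n) (x : Label) (Γ Δ : List (Elem n))
    → ((lab x (t φ) ∷ tL Γ ⊢ tL Δ) → (lab x φ ∷ tL Γ ⊢ tL Δ))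
    × ((tL Γ ⊢ lab x (t φ) ∷ tL Δ) → (tL Γ ⊢ lab x φ ∷ tL Δ))
mainTheorem2 φ x Γ Δ =
    (λ d → ⊢-expand d (lab (t-reduct φ) ∷ unchanged) unchanged)
  , (λ d → ⊢-expand d unchanged (lab (t-reduct φ) ∷ unchanged))
  where
    unchanged : ∀ {Θ} → Pointwise _↝ᴱ_ Θ Θ
    unchanged = Pointwise.refl ↝ᴱ-refl
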